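{- Let $Y=(y_{ij})\in M_n(\mathbb{Z})$ be a symmetric integer matrix with $y_{ii}=0$ for all $i\in[n]$. Then: (1) $\operatorname{tr}(XY)\equiv 0\pmod 2$ for every symmetric matrix $X\in M_n(\mathbb{Z})$; (2) $\det(R)\equiv\det(R+2Y)\pmod 4$ for every symmetric matrix $R\in M_n(\mathbb{Z})$.
   Context: $M_n(\mathbb{Z})$ denotes the set of $n\times n$ integer matrices and $[n]=\{1,\dots,n\}$. -}

module Defs where

open import Data.Nat using (ℕ; zero; suc)
open import Data.Fin using (Fin; zero; suc; punchIn)
open import Data.Integer using (ℤ; +_; _+_; _-_; _*_; -_)
open import Data.Integer.Divisibility using (_∣_)
open import Relation.Binary.PropositionalEquality using (_≡_)

Matrix : ℕ → Set
Matrix n = Fin n → Fin n → ℤ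

Σ : ∀ {n} → (Fin n → ℤ) → ℤ
Σ {zero}  f = + 0
Σ {suc n} f = f zero + Σ (λ i → f (suc i))

infixl 6 _⊕_
infixl 7 _·_ _⊗_
infix 4 _≡_[mod_]

_⊕_ : ∀ {n} → Matrix n → Matrix n → Matrix n
(A ⊕ B) i j = A i j + B i j

_·_ : ∀ {n} → ℤ → Matrix n → Matrix n
(c · A) i j = c * A i j

_⊗_ : ∀ {n} → Matrix n → Matrix n → Matrix n
(A ⊗ B) i k = Σ (λ j → A i j * B j k)

tr : ∀ {n} → Matrix n → ℤ
tr A = Σ (λ i → A i i)

Symmetric : ∀ {n} → Matrix n → Set
Symmetric A = ∀ i j → A i j ≡ A j i

sgn : ℕ → ℤ
sgn zero = + 1
sgn (suc k) = - sgn k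

det : ∀ {n} → Matrix n → ℤ
det {zero}  A = + 1
det {suc n} A = Σ (λ j → sgn (Data.Fin.toℕ j) * A zero j * det (λ r c → A (suc r) (punchIn j c)))

_≡_[mod_] : ℤ → ℤ → ℤ → Set
a ≡ b [mod m ] = m ∣ (a - b)

{-# OPTIONS --safe #-}
module Submission where

-- Both parts rest on one parity principle: if f is additive on integer matrices and
-- f (Aᵀ) = f A, then f Y is even for every symmetric Y with zero diagonal, because
-- Y = Z + Zᵀ for its strictly upper triangular part Z, whence f Y = 2 f Z.
-- Part (1) applies it to f = tr (X ⊗ _) with X symmetric. For part (2), expanding to
-- first order gives det (R + 2Y) ≡ det R + 2 D (mod 4), where D is the derivative of
-- det at R in direction Y. D is additive in Y, and transpose-invariant when R is
-- symmetric: over the dual numbers ℤ[ε], det (R + εY) = det R + ε D, and det (Aᵀ) = det A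
-- holds over every commutative ring.

open import Algebra.Bundles using (CommutativeRing)
import Algebra.Properties.Semiring.Sum as Sum
open import Data.Fin using (Fin; zero; suc; punchIn; toℕ)
open import Data.Nat using (ℕ; zero; suc)
open import Level using (Level)

private
  variable
    a : Level
    A : Set a
    n : ℕ

_ᵀ : (Fin n → Fin n → A) → Fin n → Fin n → A
(M ᵀ) i j = M j i

minor : Fin (suc n) → Fin (suc n) → (Fin (suc n) → Fin (suc n) → A) → Fin n → Fin n → A
minor i j M r c = M (punchIn i r) (punchIn j c)

module Determinant {c ℓ} (R : CommutativeRing c ℓ) where

  open CommutativeRing R hiding (zero)
  open Sum semiring using (sum; sum-cong-≋; ∑-comm; *-distribˡ-sum)
  open import Algebra.Properties.Ring ring using (-‿distribˡ-*)
  open import Algebra.Properties.CommutativeSemigroup *-commutativeSemigroup using (x∙yz≈y∙xz)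
  open import Relation.Binary.Reasoning.Setoid setoid

  sign : ℕ → Carrier
  sign zero    = 1#
  sign (suc k) = - sign k

  det : (Fin n → Fin n → Carrier) → Carrier
  det {zero}  M = 1#
  det {suc n} M = sum λ j → sign (toℕ j) * (M zero j * det (minor zero j M))

  det-cong : {M N : Fin n → Fin n → Carrier} → (∀ i j → M i j ≈ N i j) → det M ≈ det N
  det-cong {zero}  M≈N = refl
  det-cong {suc n} M≈N = sum-cong-≋ λ j →
    *-congˡ {sign (toℕ j)} (*-cong (M≈N zero j) (det-cong λ r c → M≈N (suc r) (punchIn j c)))

  private
    *-distribˡ-sum₂ : ∀ x y (f : Fin n → Carrier) → x * (y * sum f) ≈ sum λ i → x * (y * f i)
    *-distribˡ-sum₂ x y f = trans (*-congˡ (*-distribˡ-sum y f)) (*-distribˡ-sum x (λ i → y * f i))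

    cofactor-swap : ∀ x y u v p → - x * (u * (y * (v * p))) ≈ - y * (v * (x * (u * p)))
    cofactor-swap x y u v p = begin
      - x * (u * (y * (v * p)))   ≈⟨ -‿distribˡ-* x _ ⟨
      - (x * (u * (y * (v * p)))) ≈⟨ -‿cong (*-congˡ (x∙yz≈y∙xz u y _)) ⟩
      - (x * (y * (u * (v * p)))) ≈⟨ -‿cong (x∙yz≈y∙xz x y _) ⟩
      - (y * (x * (u * (v * p)))) ≈⟨ -‿cong (*-congˡ (*-congˡ (x∙yz≈y∙xz u v p))) ⟩
      - (y * (x * (v * (u * p)))) ≈⟨ -‿cong (*-congˡ (x∙yz≈y∙xz x v _)) ⟩
      - (y * (v * (x * (u * p)))) ≈⟨ -‿distribˡ-* y _ ⟩
      - y * (v * (x * (u * p)))   ∎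

  -- Expanding each minor of the first row along its first column, and each minor of
  -- the first column along its first row, produces the same double sum.
  det-expand-col₀ : (M : Fin (suc n) → Fin (suc n) → Carrier) →
                    det M ≈ sum λ i → sign (toℕ i) * (M i zero * det (minor i zero M))
  det-expand-col₀ {zero}  M = refl
  det-expand-col₀ {suc n} M = +-congˡ (begin
    sum (λ j → - s j * (row j * det (minor zero (suc j) M)))
      ≈⟨ sum-cong-≋ (λ j → *-congˡ { - s j} (*-congˡ {row j}
                             (det-expand-col₀ (minor zero (suc j) M)))) ⟩
    sum (λ j → - s j * (row j * sum λ i → s i * (col i * det (P i j))))
      ≈⟨ sum-cong-≋ (λ j → *-distribˡ-sum₂ (- s j) (row j) (λ i → s i * (col i * det (P i j)))) ⟩
    sum (λ j → sum λ i → - s j * (row j * (s i * (col i * det (P i j)))))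
      ≈⟨ ∑-comm (λ j i → - s j * (row j * (s i * (col i * det (P i j))))) ⟩
    sum (λ i → sum λ j → - s j * (row j * (s i * (col i * det (P i j)))))
      ≈⟨ sum-cong-≋ (λ i → sum-cong-≋ λ j →
           cofactor-swap (s j) (s i) (row j) (col i) (det (P i j))) ⟩
    sum (λ i → sum λ j → - s i * (col i * (s j * (row j * det (P i j)))))
      ≈⟨ sum-cong-≋ (λ i → *-distribˡ-sum₂ (- s i) (col i) (λ j → s j * (row j * det (P i j)))) ⟨
    sum (λ i → - s i * (col i * det (minor (suc i) zero M)))
      ∎)
    where
    s : Fin (suc n) → Carrier
    s k = sign (toℕ k)
    row col : Fin (suc n) → Carrier
    row j = M zero (suc j)
    col i = M (suc i) zero
    P : Fin (suc n) → Fin (suc n) → Fin n → Fin n → Carrier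
    P i j r c = M (suc (punchIn i r)) (suc (punchIn j c))

  det-transpose : (M : Fin n → Fin n → Carrier) → det (M ᵀ) ≈ det M
  det-transpose {zero}  M = refl
  det-transpose {suc n} M = begin
    det (M ᵀ)
      ≈⟨ sum-cong-≋ (λ i → *-congˡ {sign (toℕ i)} (*-congˡ {M i zero}
                             (det-transpose (minor i zero M)))) ⟩
    sum (λ i → sign (toℕ i) * (M i zero * det (minor i zero M)))
      ≈⟨ det-expand-col₀ M ⟨
    det M
      ∎

open import Defs
open import Algebra.Bundles using (Ring)
import Algebra.Module.Construct.TensorUnit as TensorUnit
open import Data.Bool using (if_then_else_)
open import Data.Fin.Properties using (_<?_; <-cmp; <-irrefl)
open import Data.Integer using (ℤ; +_; _+_; _-_; _*_; -_)
import Data.Integer.Properties as ℤ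
open import Data.Integer.Divisibility.Signed
  using (_∣_; divides; ∣m∣n⇒∣m+n; ∣m⇒∣-m; ∣n⇒∣m*n; *-monoʳ-∣; ∣⇒∣ᵤ)
open import Data.Integer.Tactic.RingSolver using (solve-∀)
open import Data.Product using (_×_; _,_; proj₁; proj₂)
open import Relation.Binary.Definitions using (tri<; tri≈; tri>)
open import Relation.Binary.PropositionalEquality
open import Relation.Nullary.Decidable using (does; dec-true; dec-false)
open import Algebra.Module.Construct.Idealization ℤ.+-*-ring TensorUnit.bimodule
  using () renaming (ringᴺ to ℤ⋉ℤ)

open ≡-Reasoning

module ℤΣ = Sum ℤ.+-*-semiring

Σ≡sum : (f : Fin n → ℤ) → Σ f ≡ ℤΣ.sum f
Σ≡sum {zero}  f = refl
Σ≡sum {suc n} f = cong (_+_ (f zero)) (Σ≡sum (λ i → f (suc i)))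

Σ-cong : {f g : Fin n → ℤ} → (∀ i → f i ≡ g i) → Σ f ≡ Σ g
Σ-cong {zero}  f≗g = refl
Σ-cong {suc n} f≗g = cong₂ _+_ (f≗g zero) (Σ-cong (λ i → f≗g (suc i)))

Σ-distrib-+ : (f g : Fin n → ℤ) → Σ (λ i → f i + g i) ≡ Σ f + Σ g
Σ-distrib-+ f g = begin
  Σ (λ i → f i + g i)       ≡⟨ Σ≡sum (λ i → f i + g i) ⟩
  ℤΣ.sum (λ i → f i + g i)  ≡⟨ ℤΣ.∑-distrib-+ f g ⟩
  ℤΣ.sum f + ℤΣ.sum g       ≡⟨ cong₂ _+_ (Σ≡sum f) (Σ≡sum g) ⟨
  Σ f + Σ g                 ∎

*-distribˡ-Σ : ∀ x (f : Fin n → ℤ) → x * Σ f ≡ Σ (λ i → x * f i)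
*-distribˡ-Σ x f = begin
  x * Σ f                   ≡⟨ cong (x *_) (Σ≡sum f) ⟩
  x * ℤΣ.sum f              ≡⟨ ℤΣ.*-distribˡ-sum x f ⟩
  ℤΣ.sum (λ i → x * f i)    ≡⟨ Σ≡sum (λ i → x * f i) ⟨
  Σ (λ i → x * f i)         ∎

Σ-comm : ∀ {m} (f : Fin m → Fin n → ℤ) → Σ (λ i → Σ (f i)) ≡ Σ (λ j → Σ λ i → f i j)
Σ-comm f = begin
  Σ (λ i → Σ (f i))                  ≡⟨ Σ-cong (λ i → Σ≡sum (f i)) ⟩
  Σ (λ i → ℤΣ.sum (f i))             ≡⟨ Σ≡sum (λ i → ℤΣ.sum (f i)) ⟩
  ℤΣ.sum (λ i → ℤΣ.sum (f i))        ≡⟨ ℤΣ.∑-comm f ⟩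
  ℤΣ.sum (λ j → ℤΣ.sum λ i → f i j)  ≡⟨ Σ≡sum (λ j → ℤΣ.sum λ i → f i j) ⟨
  Σ (λ j → ℤΣ.sum λ i → f i j)       ≡⟨ Σ-cong (λ j → Σ≡sum (λ i → f i j)) ⟨
  Σ (λ j → Σ λ i → f i j)            ∎

∣-pointwise⇒∣Σ-Σ : ∀ {m} (f g : Fin n → ℤ) → (∀ i → m ∣ f i - g i) → m ∣ Σ f - Σ g
∣-pointwise⇒∣Σ-Σ {zero}  f g m∣f-g = divides (+ 0) refl
∣-pointwise⇒∣Σ-Σ {suc n} f g m∣f-g =
  subst (_ ∣_) (regroup (f zero) (g zero) (Σ λ i → f (suc i)) (Σ λ i → g (suc i)))
    (∣m∣n⇒∣m+n (m∣f-g zero) (∣-pointwise⇒∣Σ-Σ _ _ λ i → m∣f-g (suc i)))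
  where
  regroup : ∀ a b c d → (a - b) + (c - d) ≡ (a + c) - (b + d)
  regroup = solve-∀

-- The dual numbers ℤ[ε], ε² = 0, as the library's idealization ℤ ⋉ ℤ (pairs a + εb).
ℤ[ε] : CommutativeRing _ _
ℤ[ε] = record
  { isCommutativeRing = record { isRing = Ring.isRing ℤ⋉ℤ ; *-comm = *-comm } }
  where
  ε-part-comm : ∀ a b c d → a * d + b * c ≡ c * b + d * a
  ε-part-comm = solve-∀
  *-comm : ∀ x y → Ring._≈_ ℤ⋉ℤ (Ring._*_ ℤ⋉ℤ x y) (Ring._*_ ℤ⋉ℤ y x)
  *-comm (a , b) (c , d) = ℤ.*-comm a c , ε-part-comm a b c d

module Σᴰ = Sum (CommutativeRing.semiring ℤ[ε])
module ε where
  open Determinant ℤ[ε] public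
  open CommutativeRing ℤ[ε] public using (_*_; trans; reflexive)
open CommutativeRing ℤ[ε] using () renaming (_≈_ to _≈ᴰ_)

_+ε_ : Matrix n → Matrix n → Fin n → Fin n → ℤ × ℤ
(A +ε B) i j = A i j , B i j

-- dDet A B is the derivative at t = 0 of det (A + t B), obtained by differentiating
-- the Laplace expansion of Defs.det.
dDet : Matrix n → Matrix n → ℤ
dDet {zero}  A B = + 0
dDet {suc n} A B = Σ λ j →
  sgn (toℕ j) * (A zero j * dDet (minor zero j A) (minor zero j B) + B zero j * det (minor zero j A))

sign≡sgn : ∀ k → ε.sign k ≡ (sgn k , + 0)
sign≡sgn zero    = refl
sign≡sgn (suc k) = cong (λ x → - proj₁ x , - proj₂ x) (sign≡sgn k)

sumᴰ-pair : (f g : Fin n → ℤ) → Σᴰ.sum (λ i → f i , g i) ≡ (Σ f , Σ g)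
sumᴰ-pair {zero}  f g = refl
sumᴰ-pair {suc n} f g =
  cong (λ x → f zero + proj₁ x , g zero + proj₂ x) (sumᴰ-pair (λ i → f (suc i)) (λ i → g (suc i)))

det-dual : (A B : Matrix n) → ε.det (A +ε B) ≈ᴰ (det A , dDet A B)
det-dual {zero}  A B = refl , refl
det-dual {suc n} A B = ε.trans (Σᴰ.sum-cong-≋ cofactor) (ε.reflexive (sumᴰ-pair F G))
  where
  s : Fin (suc n) → ℤ
  s j = sgn (toℕ j)
  M N : Fin (suc n) → Matrix n
  M j = minor zero j A
  N j = minor zero j B
  F G : Fin (suc n) → ℤ
  F j = s j * A zero j * det (M j)
  G j = s j * (A zero j * dDet (M j) (N j) + B zero j * det (M j))
  cofactor : ∀ j → ε.sign (toℕ j) ε.* ((A zero j , B zero j) ε.* ε.det (M j +ε N j)) ≈ᴰ (F j , G j)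
  cofactor j rewrite sign≡sgn (toℕ j) with ε.det (M j +ε N j) | det-dual (M j) (N j)
  ... | _ , _ | refl , refl =
    sym (ℤ.*-assoc (s j) (A zero j) (det (M j))) ,
    trans (cong (_+_ (G j)) (ℤ.*-zeroˡ (A zero j * det (M j)))) (ℤ.+-identityʳ (G j))

dDet-via-dual : (A B A′ B′ : Matrix n) → ε.det (A +ε B) ≈ᴰ ε.det (A′ +ε B′) →
                dDet A B ≡ dDet A′ B′
dDet-via-dual A B A′ B′ eq = begin
  dDet A B                   ≡⟨ proj₂ (det-dual A B) ⟨
  proj₂ (ε.det (A +ε B))     ≡⟨ proj₂ eq ⟩
  proj₂ (ε.det (A′ +ε B′))   ≡⟨ proj₂ (det-dual A′ B′) ⟩
  dDet A′ B′                 ∎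

dDet-cong : {A A′ B B′ : Matrix n} → (∀ i j → A i j ≡ A′ i j) → (∀ i j → B i j ≡ B′ i j) →
            dDet A B ≡ dDet A′ B′
dDet-cong {A = A} {A′} {B} {B′} A≗A′ B≗B′ =
  dDet-via-dual A B A′ B′ (ε.det-cong {M = A +ε B} λ i j → A≗A′ i j , B≗B′ i j)

dDet-transpose : (A B : Matrix n) → dDet (A ᵀ) (B ᵀ) ≡ dDet A B
dDet-transpose A B = dDet-via-dual (A ᵀ) (B ᵀ) A B (ε.det-transpose (A +ε B))

dDet-distribˡ-⊕ : (A B C : Matrix n) → dDet A (B ⊕ C) ≡ dDet A B + dDet A C
dDet-distribˡ-⊕ {zero}  A B C = refl
dDet-distribˡ-⊕ {suc n} A B C = trans (Σ-cong cofactor) (Σ-distrib-+ (t B) (t C))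
  where
  t : Matrix (suc n) → Fin (suc n) → ℤ
  t D j = sgn (toℕ j) * (A zero j * dDet (minor zero j A) (minor zero j D) + D zero j * det (minor zero j A))
  split : ∀ s a b c x y d → s * (a * (x + y) + (b + c) * d) ≡ s * (a * x + b * d) + s * (a * y + c * d)
  split = solve-∀
  cofactor : ∀ j → t (B ⊕ C) j ≡ t B j + t C j
  cofactor j rewrite dDet-distribˡ-⊕ (minor zero j A) (minor zero j B) (minor zero j C) =
    split (sgn (toℕ j)) (A zero j) (B zero j) (C zero j)
          (dDet (minor zero j A) (minor zero j B)) (dDet (minor zero j A) (minor zero j C)) (det (minor zero j A))

det-first-order-mod4 : (A B : Matrix n) → + 4 ∣ det (A ⊕ + 2 · B) - (det A + + 2 * dDet A B)
det-first-order-mod4 {zero}  A B = divides (+ 0) refl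
det-first-order-mod4 {suc n} A B =
  subst (λ x → + 4 ∣ det (A ⊕ + 2 · B) - x) (sym linear)
    (∣-pointwise⇒∣Σ-Σ F (λ j → G j + + 2 * H j) cofactor)
  where
  s : Fin (suc n) → ℤ
  s j = sgn (toℕ j)
  M N : Fin (suc n) → Matrix n
  M j = minor zero j A
  N j = minor zero j B
  F G H : Fin (suc n) → ℤ
  F j = s j * (A zero j + + 2 * B zero j) * det (M j ⊕ + 2 · N j)
  G j = s j * A zero j * det (M j)
  H j = s j * (A zero j * dDet (M j) (N j) + B zero j * det (M j))
  linear : det A + + 2 * dDet A B ≡ Σ (λ j → G j + + 2 * H j)
  linear = trans (cong (_+_ (det A)) (*-distribˡ-Σ (+ 2) H)) (sym (Σ-distrib-+ G (λ j → + 2 * H j)))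
  expand : ∀ s a b d e D → s * (a + + 2 * b) * D - (s * a * d + + 2 * (s * (a * e + b * d)))
                          ≡ s * (a + + 2 * b) * (D - (d + + 2 * e)) + s * b * e * + 4
  expand = solve-∀
  cofactor : ∀ j → + 4 ∣ F j - (G j + + 2 * H j)
  cofactor j =
    subst (+ 4 ∣_)
      (sym (expand (s j) (A zero j) (B zero j) (det (M j)) (dDet (M j) (N j)) (det (M j ⊕ + 2 · N j))))
      (∣m∣n⇒∣m+n (∣n⇒∣m*n (s j * (A zero j + + 2 * B zero j)) (det-first-order-mod4 (M j) (N j)))
                 (divides (s j * B zero j * dDet (M j) (N j)) refl))

tr-⊗-congʳ : (X : Matrix n) {A B : Matrix n} → (∀ i j → A i j ≡ B i j) → tr (X ⊗ A) ≡ tr (X ⊗ B)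
tr-⊗-congʳ X A≗B = Σ-cong λ i → Σ-cong λ j → cong (X i j *_) (A≗B j i)

tr-⊗-distribˡ-⊕ : (X A B : Matrix n) → tr (X ⊗ (A ⊕ B)) ≡ tr (X ⊗ A) + tr (X ⊗ B)
tr-⊗-distribˡ-⊕ X A B = trans
  (Σ-cong λ i → trans (Σ-cong λ j → ℤ.*-distribˡ-+ (X i j) (A j i) (B j i))
                      (Σ-distrib-+ (λ j → X i j * A j i) (λ j → X i j * B j i)))
  (Σ-distrib-+ (λ i → (X ⊗ A) i i) (λ i → (X ⊗ B) i i))

tr-⊗-transposeʳ : {X : Matrix n} → Symmetric X → (A : Matrix n) → tr (X ⊗ A ᵀ) ≡ tr (X ⊗ A)
tr-⊗-transposeʳ {X = X} X-sym A = trans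
  (Σ-comm λ i j → X i j * A i j)
  (Σ-cong λ j → Σ-cong λ i → cong (_* A i j) (X-sym i j))

strictUpper : Matrix n → Matrix n
strictUpper Y i j = if does (i <? j) then Y i j else + 0

hollowSymmetric-split : {Y : Matrix n} → Symmetric Y → (∀ i → Y i i ≡ + 0) →
                        ∀ i j → Y i j ≡ (strictUpper Y ⊕ strictUpper Y ᵀ) i j
hollowSymmetric-split {Y = Y} Y-sym Y-hollow i j with <-cmp i j
... | tri< i<j _ j≮i rewrite dec-true (i <? j) i<j | dec-false (j <? i) j≮i =
  sym (ℤ.+-identityʳ (Y i j))
... | tri≈ _ refl _  rewrite dec-false (i <? i) (<-irrefl refl) = Y-hollow i
... | tri> i≮j _ j<i rewrite dec-false (i <? j) i≮j | dec-true (j <? i) j<i =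
  trans (Y-sym i j) (sym (ℤ.+-identityˡ (Y j i)))

hollowSymmetric⇒2∣ : (f : Matrix n → ℤ) →
                     (∀ {A B} → (∀ i j → A i j ≡ B i j) → f A ≡ f B) →
                     (∀ A B → f (A ⊕ B) ≡ f A + f B) →
                     (∀ A → f (A ᵀ) ≡ f A) →
                     {Y : Matrix n} → Symmetric Y → (∀ i → Y i i ≡ + 0) → + 2 ∣ f Y
hollowSymmetric⇒2∣ {n = n} f f-cong f-additive f-transpose {Y} Y-sym Y-hollow = divides (f Z) (begin
  f Y            ≡⟨ f-cong (hollowSymmetric-split Y-sym Y-hollow) ⟩
  f (Z ⊕ Z ᵀ)    ≡⟨ f-additive Z (Z ᵀ) ⟩
  f Z + f (Z ᵀ)  ≡⟨ cong (_+_ (f Z)) (f-transpose Z) ⟩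
  f Z + f Z      ≡⟨ twice (f Z) ⟩
  f Z * + 2      ∎)
  where
  Z : Matrix n
  Z = strictUpper Y
  twice : ∀ x → x + x ≡ x * + 2
  twice = solve-∀

lemma2p3 : (n : ℕ) (Y : Matrix n) → Symmetric Y → (∀ i → Y i i ≡ + 0) →
    ((X : Matrix n) → Symmetric X → tr (X ⊗ Y) ≡ + 0 [mod + 2 ])
    × ((R : Matrix n) → Symmetric R → det R ≡ det (R ⊕ (+ 2 · Y)) [mod + 4 ])
lemma2p3 n Y Y-sym Y-hollow = trace-even , det-mod4
  where
  trace-even : (X : Matrix n) → Symmetric X → tr (X ⊗ Y) ≡ + 0 [mod + 2 ]
  trace-even X X-sym = ∣⇒∣ᵤ (subst (+ 2 ∣_) (sym (ℤ.+-identityʳ (tr (X ⊗ Y))))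
    (hollowSymmetric⇒2∣ (λ A → tr (X ⊗ A)) (tr-⊗-congʳ X) (tr-⊗-distribˡ-⊕ X)
                        (tr-⊗-transposeʳ X-sym) Y-sym Y-hollow))
  det-mod4 : (R : Matrix n) → Symmetric R → det R ≡ det (R ⊕ (+ 2 · Y)) [mod + 4 ]
  det-mod4 R R-sym = ∣⇒∣ᵤ (subst (+ 4 ∣_) (rearrange (det R) (det (R ⊕ + 2 · Y)) (dDet R Y))
    (∣m⇒∣-m (∣m∣n⇒∣m+n (det-first-order-mod4 R Y) (*-monoʳ-∣ (+ 2) dDet-even))))
    where
    dDet-even : + 2 ∣ dDet R Y
    dDet-even = hollowSymmetric⇒2∣ (dDet R) (dDet-cong (λ _ _ → refl)) (dDet-distribˡ-⊕ R)
      (λ A → trans (dDet-cong R-sym (λ _ _ → refl)) (dDet-transpose R A)) Y-sym Y-hollow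
    rearrange : ∀ a b d → - ((b - (a + + 2 * d)) + + 2 * d) ≡ a - b
    rearrange = solve-∀
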